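{- If a sequent $A \vdash_{\mathsf{L}} B$ is valid in every $\mathtt{SkMBiCA}$ model (i.e. $v(A)\subseteq v(B)$ in every model), then it is derivable in $\mathtt{SkMBiCA}$.
   Context: Formulae are generated by $A,B ::= X \mid \mathsf{I} \mid A \otimes^{\mathsf{L}} B \mid A \multimap^{\mathsf{L}} B \mid A \otimes^{\mathsf{R}} B \mid A \multimap^{\mathsf{R}} B$, with $X$ ranging over a set of atoms. $\mathtt{SkMBiCA}$ has sequents $A \vdash_{\mathsf{L}} B$ generated by: (id) $A\vdash_{\mathsf{L}} A$; (comp) from $A \vdash_{\mathsf{L}} B$ and $B \vdash_{\mathsf{L}} C$ infer $A \vdash_{\mathsf{L}} C$; ($\otimes^{\mathsf{L}}$) from $A\vdash_{\mathsf{L}} C$, $B \vdash_{\mathsf{L}} D$ infer $A\otimes^{\mathsf{L}} B \vdash_{\mathsf{L}} C \otimes^{\mathsf{L}} D$; ($\multimap^{\mathsf{L}}$) from $C \vdash_{\mathsf{L}} A$, $B \vdash_{\mathsf{L}} D$ infer $A\multimap^{\mathsf{L}} B \vdash_{\mathsf{L}} C\multimap^{\mathsf{L}} D$; ($\multimap^{\mathsf{R}}$) from $C \vdash_{\mathsf{L}} A$, $B \vdash_{\mathsf{L}} D$ infer $A\multimap^{\mathsf{R}} B \vdash_{\mathsf{L}} C\multimap^{\mathsf{R}} D$; axioms ($\lambda$) $\mathsf{I}\otimes^{\mathsf{L}} A \vdash_{\mathsf{L}} A$, ($\rho$) $A \vdash_{\mathsf{L}} A \otimes^{\mathsf{L}}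 \mathsf{I}$, ($\alpha$) $(A\otimes^{\mathsf{L}} B)\otimes^{\mathsf{L}} C \vdash_{\mathsf{L}} A \otimes^{\mathsf{L}}(B\otimes^{\mathsf{L}} C)$, ($\gamma$) $A \otimes^{\mathsf{L}} B \vdash_{\mathsf{L}} B \otimes^{\mathsf{R}} A$, ($\gamma^{ -1}$) $A \otimes^{\mathsf{R}} B \vdash_{\mathsf{L}} B \otimes^{\mathsf{L}} A$; bidirectional rules ($\pi$) $A \vdash_{\mathsf{L}} B \multimap^{\mathsf{L}} C$ iff $A \otimes^{\mathsf{L}} B \vdash_{\mathsf{L}} C$, ($\pi^{\mathsf{R}}$) $A \vdash_{\mathsf{L}} B \multimap^{\mathsf{R}} C$ iff $A \otimes^{\mathsf{R}} B \vdash_{\mathsf{L}} C$. A $\mathtt{SkMBiCA}$ frame is $\langle W,\leq,\mathbb{I},\mathbb{L},\mathbb{R}\rangle$ with $W$ a set, $\le$ a preorder, $\mathbb{I}\subseteq W$ downward closed, $\mathbb{L},\mathbb{R}\subseteq W^3$ upward closed in their first two arguments and downward closed in their third, satisfying: ($\mathbb{LR}$-reverse) $\mathbb{L}abc \iff \mathbb{R}bac$; (LSA) if $\mathbb{L}abx$ and $\mathbb{L}xcd$ then there is $y$ with $\mathbb{L}bcy$ and $\mathbb{L}ayd$; (LSLU) for $a,b\in W$, $e\in\mathbb{I}$, $\mathbb{L}eab$ implies $b\le a$; (LSRU) for every $a$ there is $e\in\mathbb{I}$ with $\mathbb{L}aea$. A valuation is a map $v$ from formulae to downward closed subsets of $W$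 with $v(\mathsf{I})=\mathbb{I}$, $v(A\otimes^{\mathsf{L}} B) = \{c : \exists a\in v(A), b\in v(B), \mathbb{L}abc\}$, $v(A\multimap^{\mathsf{L}} B)=\{c : \forall a\in v(A), b\in W, \mathbb{L}cab \Rightarrow b\in v(B)\}$, and analogously for $\otimes^{\mathsf{R}},\multimap^{\mathsf{R}}$ with $\mathbb{R}$. A $\mathtt{SkMBiCA}$ model is a $\mathtt{SkMBiCA}$ frame with a valuation. -}

module Defs where

open import Level using (Level; _⊔_) renaming (suc to lsuc; zero to lzero)
open import Data.Product using (Σ; ∃; _×_; _,_)
open import Relation.Binary using (Rel; IsPreorder)

data Fma (At : Set) : Set where
  ` : At → Fma At
  I : Fma At
  _⊗L_ : Fma At → Fma At → Fma At
  _⊸L_ : Fma At → Fma At → Fma At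
  _⊗R_ : Fma At → Fma At → Fma At
  _⊸R_ : Fma At → Fma At → Fma At

infixr 30 _⊗L_ _⊗R_
infixr 25 _⊸L_ _⊸R_
infix 15 _⊢L_

data _⊢L_ {At : Set} : Fma At → Fma At → Set where
  id   : ∀ {A} → A ⊢L A
  comp : ∀ {A B C} → A ⊢L B → B ⊢L C → A ⊢L C
  ⊗L-rule : ∀ {A B C D} → A ⊢L C → B ⊢L D → A ⊗L B ⊢L C ⊗L D
  ⊸L-rule : ∀ {A B C D} → C ⊢L A → B ⊢L D → A ⊸L B ⊢L C ⊸L D
  ⊸R-rule : ∀ {A B C D} → C ⊢L A → B ⊢L D → A ⊸R B ⊢L C ⊸R D
  λ-ax : ∀ {A} → I ⊗L A ⊢L A
  ρ-ax : ∀ {A} → A ⊢L A ⊗L I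
  α-ax : ∀ {A B C} → (A ⊗L B) ⊗L C ⊢L A ⊗L (B ⊗L C)
  γ-ax : ∀ {A B} → A ⊗L B ⊢L B ⊗R A
  γ⁻¹-ax : ∀ {A B} → A ⊗R B ⊢L B ⊗L A
  π    : ∀ {A B C} → A ⊗L B ⊢L C → A ⊢L B ⊸L C
  π⁻¹  : ∀ {A B C} → A ⊢L B ⊸L C → A ⊗L B ⊢L C
  πR   : ∀ {A B C} → A ⊗R B ⊢L C → A ⊢L B ⊸R C
  πR⁻¹ : ∀ {A B C} → A ⊢L B ⊸R C → A ⊗R B ⊢L C

record Frame : Set₁ where
  field
    W   : Set
    _≤_ : W → W → Set
    ≤-refl  : ∀ {a} → a ≤ a
    ≤-trans : ∀ {a b c} → a ≤ b → b ≤ c → a ≤ c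
    𝕀 : W → Set
    𝕃 : W → W → W → Set
    ℝ : W → W → W → Set
    𝕀-down : ∀ {a b} → b ≤ a → 𝕀 a → 𝕀 b
    𝕃-mono : ∀ {a a' b b' c c'} → a ≤ a' → b ≤ b' → c' ≤ c → 𝕃 a b c → 𝕃 a' b' c'
    ℝ-mono : ∀ {a a' b b' c c'} → a ≤ a' → b ≤ b' → c' ≤ c → ℝ a b c → ℝ a' b' c'
    LR-reverse₁ : ∀ {a b c} → 𝕃 a b c → ℝ b a c
    LR-reverse₂ : ∀ {a b c} → ℝ b a c → 𝕃 a b c
    LSA : ∀ {a b c d x} → 𝕃 a b x → 𝕃 x c d → Σ W (λ y → 𝕃 b c y × 𝕃 a y d)
    LSLU : ∀ {a b e} → 𝕀 e → 𝕃 e a b → b ≤ a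
    LSRU : ∀ a → Σ W (λ e → 𝕀 e × 𝕃 a e a)

record Model (At : Set) : Set₁ where
  field
    frame : Frame
  open Frame frame public
  field
    val      : At → W → Set
    val-down : ∀ {X a b} → b ≤ a → val X a → val X b

module _ {At : Set} (M : Model At) where
  open Model M

  ⟦_⟧ : Fma At → W → Set
  ⟦ ` X ⟧ c = val X c
  ⟦ I ⟧ c = 𝕀 c
  ⟦ A ⊗L B ⟧ c = Σ W λ a → Σ W λ b → ⟦ A ⟧ a × ⟦ B ⟧ b × 𝕃 a b c
  ⟦ A ⊸L B ⟧ c = ∀ a b → ⟦ A ⟧ a → 𝕃 c a b → ⟦ B ⟧ b
  ⟦ A ⊗R B ⟧ c = Σ W λ a → Σ W λ b → ⟦ A ⟧ a × ⟦ B ⟧ b × ℝ a b c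
  ⟦ A ⊸R B ⟧ c = ∀ a b → ⟦ A ⟧ a → ℝ c a b → ⟦ B ⟧ b

_⊨_⇒_ : {At : Set} → Model At → Fma At → Fma At → Set
M ⊨ A ⇒ B = ∀ w → ⟦ M ⟧ A w → ⟦ M ⟧ B w

Valid : {At : Set} → Fma At → Fma At → Set₁
Valid {At} A B = (M : Model At) → M ⊨ A ⇒ B

-- Canonical model: the worlds are the formulae, preordered by derivability, with
-- 𝕀 e iff e ⊢ I, 𝕃 a b c iff c ⊢ a ⊗L b and ℝ a b c iff c ⊢ a ⊗R b; each frame
-- condition is one of the axioms of the calculus read backwards. The truth lemma
-- ⟦ A ⟧ c ⟺ c ⊢ A holds by induction on A, the implication cases testing the
-- hypothesis at the world c ⊗ A and closing with π. Validity at the world A,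
-- where A holds by id, then yields A ⊢ B.
module Submission where

open import Defs
open import Data.Product using (_,_)

⊗R-rule : {At : Set} {A B C D : Fma At} → A ⊢L C → B ⊢L D → A ⊗R B ⊢L C ⊗R D
⊗R-rule f g = comp γ⁻¹-ax (comp (⊗L-rule g f) γ-ax)

module Canonical {At : Set} where

  frame : Frame
  frame = record
    { W           = Fma At
    ; _≤_         = _⊢L_
    ; ≤-refl      = id
    ; ≤-trans     = comp
    ; 𝕀           = λ e → e ⊢L I
    ; 𝕃           = λ a b c → c ⊢L a ⊗L b
    ; ℝ           = λ a b c → c ⊢L a ⊗R b
    ; 𝕀-down      = comp
    ; 𝕃-mono      = λ f g h k → comp h (comp k (⊗L-rule f g))
    ; ℝ-mono      = λ f g h k → comp h (comp k (⊗R-rule f g))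
    ; LR-reverse₁ = λ k → comp k γ-ax
    ; LR-reverse₂ = λ k → comp k γ⁻¹-ax
    ; LSA         = λ {b = b} {c = c} f g → b ⊗L c , id , comp g (comp (⊗L-rule f id) α-ax)
    ; LSLU        = λ e k → comp k (comp (⊗L-rule e id) λ-ax)
    ; LSRU        = λ a → I , id , ρ-ax
    }

  model : Model At
  model = record { frame = frame ; val = λ X a → a ⊢L ` X ; val-down = comp }

  mutual
    ⟦⟧⇒⊢ : (A c : Fma At) → ⟦ model ⟧ A c → c ⊢L A
    ⟦⟧⇒⊢ (` X)    c p                 = p
    ⟦⟧⇒⊢ I        c p                 = p
    ⟦⟧⇒⊢ (A ⊗L B) c (a , b , p , q , k) = comp k (⊗L-rule (⟦⟧⇒⊢ A a p) (⟦⟧⇒⊢ B b q))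
    ⟦⟧⇒⊢ (A ⊗R B) c (a , b , p , q , k) = comp k (⊗R-rule (⟦⟧⇒⊢ A a p) (⟦⟧⇒⊢ B b q))
    ⟦⟧⇒⊢ (A ⊸L B) c p                 = π (⟦⟧⇒⊢ B (c ⊗L A) (p A (c ⊗L A) (⊢⇒⟦⟧ A A id) id))
    ⟦⟧⇒⊢ (A ⊸R B) c p                 = πR (⟦⟧⇒⊢ B (c ⊗R A) (p A (c ⊗R A) (⊢⇒⟦⟧ A A id) id))

    ⊢⇒⟦⟧ : (A c : Fma At) → c ⊢L A → ⟦ model ⟧ A c
    ⊢⇒⟦⟧ (` X)    c k         = k
    ⊢⇒⟦⟧ I        c k         = k
    ⊢⇒⟦⟧ (A ⊗L B) c k         = A , B , ⊢⇒⟦⟧ A A id , ⊢⇒⟦⟧ B B id , k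
    ⊢⇒⟦⟧ (A ⊗R B) c k         = A , B , ⊢⇒⟦⟧ A A id , ⊢⇒⟦⟧ B B id , k
    ⊢⇒⟦⟧ (A ⊸L B) c k a b p h = ⊢⇒⟦⟧ B b (comp h (comp (⊗L-rule id (⟦⟧⇒⊢ A a p)) (π⁻¹ k)))
    ⊢⇒⟦⟧ (A ⊸R B) c k a b p h = ⊢⇒⟦⟧ B b (comp h (comp (⊗R-rule id (⟦⟧⇒⊢ A a p)) (πR⁻¹ k)))

mainTheorem9 : {At : Set} (A B : Fma At) → Valid A B → A ⊢L B
mainTheorem9 A B valid = ⟦⟧⇒⊢ B A (valid model A (⊢⇒⟦⟧ A A id))
  where open Canonical
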